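{- Let $Q$ be a finite (left) quasifield of order $q$, $n\ge1$, and let $B=\{[\vec{x},\vec{y},z]:\vec x\in X_1\times\dots\times X_n,\ \vec y\in Y_1\times\dots\times Y_n,\ z\in Z\}\subseteq H_n(Q)$ be a brick with nonempty $X_i,Y_i,Z\subseteq Q$. Let $\vec a=(a_1,\dots,a_n),\vec b=(b_1,\dots,b_n)\in Q^n$ and suppose \[ |Z|^2\prod_{i=1}^n|X_i\cap(a_i-X_i)|\,|Y_i\cap(b_i-Y_i)|>2q^{n+2}. \] Then $B\cdot B\supseteq[\vec a,\vec b,Q]=\{[\vec a,\vec b,z]:z\in Q\}$.
   Context: A loop is a set $L$ with a binary operation $*$ such that for all $a,b\in L$ the equations $a*x=b$ and $y*a=b$ have unique solutions, and there is an identity $e$ with $e*x=x*e=x$. A (left) quasifield is a set $Q$ with operations $+$ and $*$ such that $(Q,+)$ is a group with identity $0$, $(Q\setminus\{0\},*)$ is a loop, $a*(b+c)=a*b+a*c$, $0*x=0$, and for all $a,b,c\in Q$ with $a\ne b$ the equation $a*x=b*x+c$ has exactly one solution. $H_n(Q)$ is the set of triples $[\vec{x},\vec{y},z]$ with $\vec x,\vec y\in Q^n$, $z\in Q$, with multiplication $[\vec{x},\vec{y},z]\cdot[\vec{x}',\vec{y}',z']=[\vec{x}+\vec{x}',\vec{y}+\vec{y}',z+z'+\sum_{i=1}^n x_i*y_i']$. $B\cdot B=\{bb':b,b'\in B\}$, and $a-X=\{a-x:x\in X\}$. -}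

module Defs where

open import Data.Nat using (ℕ; zero; suc) renaming (_*_ to _*ℕ_)
open import Data.Fin using (Fin; zero; suc)
open import Data.Fin.Subset using (Subset; _∈_)
open import Data.Vec using (Vec; []; _∷_; tabulate; lookup; zipWith)
open import Data.Bool using (Bool; true; false)
open import Data.Product using (Σ; _×_; _,_)
open import Relation.Nullary using (¬_; does)
open import Relation.Binary.PropositionalEquality using (_≡_)
open import Data.Fin.Subset.Properties using (_∈?_)
open import Data.Fin.Properties using () renaming (_≟_ to _≟F_)
open import Data.Fin.Properties using (any?)
open import Relation.Nullary using (Dec)
open import Relation.Nullary.Decidable using (_×-dec_)

∃!⟨_⟩ : {A : Set} → (A → Set) → (A → Set) → Set
∃!⟨_⟩ {A} D P = Σ A λ x → (D x × P x) × (∀ y → D y → P y → y ≡ x)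

record Quasifield (q : ℕ) : Set where
  infixl 6 _+_
  infixl 7 _*_
  field
    _+_ : Fin q → Fin q → Fin q
    -_  : Fin q → Fin q
    0#  : Fin q
    _*_ : Fin q → Fin q → Fin q
    e   : Fin q
    +-assoc   : ∀ a b c → (a + b) + c ≡ a + (b + c)
    +-identityˡ : ∀ a → 0# + a ≡ a
    +-identityʳ : ∀ a → a + 0# ≡ a
    -‿inverseˡ : ∀ a → (- a) + a ≡ 0#
    -‿inverseʳ : ∀ a → a + (- a) ≡ 0#
    *-closed  : ∀ a b → ¬ a ≡ 0# → ¬ b ≡ 0# → ¬ (a * b) ≡ 0#
    e≢0       : ¬ e ≡ 0#
    e-identityˡ : ∀ x → ¬ x ≡ 0# → e * x ≡ x
    e-identityʳ : ∀ x → ¬ x ≡ 0# → x * e ≡ x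
    left-div  : ∀ a b → ¬ a ≡ 0# → ¬ b ≡ 0# →
                ∃!⟨ (λ x → ¬ x ≡ 0#) ⟩ (λ x → a * x ≡ b)
    right-div : ∀ a b → ¬ a ≡ 0# → ¬ b ≡ 0# →
                ∃!⟨ (λ y → ¬ y ≡ 0#) ⟩ (λ y → y * a ≡ b)
    distribˡ  : ∀ a b c → a * (b + c) ≡ a * b + a * c
    zeroˡ     : ∀ x → 0# * x ≡ 0#
    unique-sol : ∀ a b c → ¬ a ≡ b →
                 ∃!⟨ (λ _ → Fin q) ⟩ (λ x → a * x ≡ b * x + c)

module _ {q : ℕ} (Q : Quasifield q) where
  open Quasifield Q

  -- a - X = { a + (- x) : x ∈ X }, as a subset of Q
  _-set_ : Fin q → Subset q → Subset q
  a -set X = tabulate λ y → does (any? {P = λ x → x ∈ X × y ≡ a + (- x)}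
                                    (λ x → help x y))
    where
    help : ∀ x y → Dec (x ∈ X × y ≡ a + (- x))
    help x y = (x ∈? X) ×-dec (y ≟F (a + (- x)))

  dotL : ∀ {n} → Fin q → Vec (Fin q) n → Vec (Fin q) n → Fin q
  dotL acc [] [] = acc
  dotL acc (x ∷ xs) (y ∷ ys) = dotL (acc + x * y) xs ys

  dot : ∀ {n} → Vec (Fin q) n → Vec (Fin q) n → Fin q
  dot = dotL 0#

  H : ℕ → Set
  H n = Vec (Fin q) n × Vec (Fin q) n × Fin q

  _·H_ : ∀ {n} → H n → H n → H n
  (x , y , z) ·H (x' , y' , z') =
    zipWith _+_ x x' , zipWith _+_ y y' , (z + z') + dot x y'

  InBrick : ∀ {n} → (Fin n → Subset q) → (Fin n → Subset q) → Subset q → H n → Set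
  InBrick X Y Z (x , y , z) = (∀ i → lookup x i ∈ X i) × (∀ i → lookup y i ∈ Y i) × z ∈ Z

prodFin : ∀ n → (Fin n → ℕ) → ℕ
prodFin zero f = 1
prodFin (suc n) f = f zero *ℕ prodFin n (λ i → f (suc i))

{-# OPTIONS --safe #-}

-- Call p = (z′, u) a point and h = (z, y) a line of Qⁿ⁺¹, and let p lie on h when
-- [u, y, z] · [u \\ a, y \\ b, z′] has last coordinate w, where x \\ c = −x + c componentwise.
-- An incidence between P = Z × ∏ (Xᵢ ∩ (aᵢ − Xᵢ)) and H = Z × ∏ (Yᵢ ∩ (bᵢ − Yᵢ)) is then
-- exactly a factorisation of [a, b, w] inside the brick.  Every point lies on qⁿ lines (z is
-- determined by y), and two distinct points share at most qⁿ⁻¹ lines, because the maps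
-- t ↦ α + x t with distinct slopes x meet at most once in a quasifield.  The second moment of
-- the number of points of P on a line is therefore small, and Cauchy–Schwarz over the lines
-- outside H shows that if H carries no point of P then |P| |H| ≤ qⁿ⁺², against the hypothesis.

module Submission where

open import Defs
open import Data.Nat using (ℕ; zero; suc; _*_; _^_; _+_; _∸_; _≤_; _<_; _>_; z≤n; s≤s; NonZero; >-nonZero)
open import Data.Nat.Properties
  using ( _≟_; ≤-reflexive; ≤-trans; ≤-total; module ≤-Reasoning
        ; +-comm; +-identityʳ; +-mono-≤; +-monoˡ-≤; +-monoʳ-≤; +-cancelʳ-≤; m≤m+n; m≤n+m
        ; *-comm; *-assoc; *-identityˡ; *-identityʳ; *-zeroʳ; *-distribˡ-+; *-distribʳ-+
        ; *-monoˡ-≤; *-monoʳ-≤; *-mono-<; *-cancelˡ-≤; m^n>0; <⇒≱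
        ; m∸n+n≡m; m∸n≤m; m≤n⇒∃[o]m+o≡n; +-*-semiring )
open import Data.Nat.Tactic.RingSolver using (solve-∀)
open import Data.Bool using (true; false)
open import Data.Empty using (⊥-elim)
open import Data.Fin using (Fin; zero; suc)
open import Data.Fin.Properties using (any?; all?; suc-injective; nonZeroIndex) renaming (_≟_ to _≟ᶠ_)
open import Data.Fin.Subset using (Subset; Nonempty; _∈_; _∩_; ∣_∣)
open import Data.Fin.Subset.Properties using (_∈?_; drop-there; p∩q⊆p; p∩q⊆q)
open import Data.Product using (Σ; _×_; _,_; proj₁; proj₂)
open import Data.Sum using ([_,_]′)
open import Data.Vec using (Vec; []; _∷_; lookup; zipWith; there)
open import Data.Vec.Functional using () renaming (_∷_ to _∷ᶠ_)
open import Data.Vec.Properties using (∷-injective; lookup∘tabulate; []=⇒lookup; lookup-zipWith)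
  renaming (≡-dec to ≡-decᵛ)
open import Function using (_∘_)
open import Level using (0ℓ)
open import Relation.Binary.PropositionalEquality
open import Relation.Nullary using (¬_; Dec; yes; no; does)
open import Relation.Nullary.Decidable using (_×-dec_)
open import Algebra.Bundles using (Group)
open import Algebra.Structures using (IsGroup)
import Algebra.Properties.Group as GroupProperties
open import Algebra.Properties.Semiring.Sum +-*-semiring
  using (sum; ∑-comm; ∑-distrib-+; *-distribˡ-sum; *-distribʳ-sum; sum-cong-≗)

-- Indicators and sums over Fin

𝟙 : {A : Set} → Dec A → ℕ
𝟙 (yes _) = 1
𝟙 (no _)  = 0

𝟙≤1 : {A : Set} (a? : Dec A) → 𝟙 a? ≤ 1
𝟙≤1 (yes _) = s≤s z≤n
𝟙≤1 (no _)  = z≤n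

𝟙≢0⇒ : {A : Set} (a? : Dec A) → 𝟙 a? ≢ 0 → A
𝟙≢0⇒ (yes a) _  = a
𝟙≢0⇒ (no _)  ≢0 = ⊥-elim (≢0 refl)

𝟙-yes : {A : Set} (a? : Dec A) → A → 𝟙 a? ≡ 1
𝟙-yes (yes _) _ = refl
𝟙-yes (no ¬a) a = ⊥-elim (¬a a)

𝟙-no : {A : Set} (a? : Dec A) → ¬ A → 𝟙 a? ≡ 0
𝟙-no (yes a) ¬a = ⊥-elim (¬a a)
𝟙-no (no _)  _  = refl

𝟙-cong : {A B : Set} (a? : Dec A) (b? : Dec B) → (A → B) → (B → A) → 𝟙 a? ≡ 𝟙 b?
𝟙-cong (yes _) (yes _) _   _   = refl
𝟙-cong (yes a) (no ¬b) a→b _   = ⊥-elim (¬b (a→b a))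
𝟙-cong (no ¬a) (yes b) _   b→a = ⊥-elim (¬a (b→a b))
𝟙-cong (no _)  (no _)  _   _   = refl

𝟙*≢0⇒ : {A : Set} (a? : Dec A) {x : ℕ} → 𝟙 a? * x ≢ 0 → A × x ≢ 0
𝟙*≢0⇒ (yes a) {x} ≢0 = a , λ x≡0 → ≢0 (trans (*-identityˡ x) x≡0)
𝟙*≢0⇒ (no _)      ≢0 = ⊥-elim (≢0 refl)

𝟙*𝟙≤𝟙*𝟙 : {A B C : Set} (a? : Dec A) (b? : Dec B) (c? : Dec C) → (A → B → C) → 𝟙 a? * 𝟙 b? ≤ 𝟙 c? * 𝟙 a?
𝟙*𝟙≤𝟙*𝟙 (yes a) (yes b) (yes _) _   = s≤s z≤n
𝟙*𝟙≤𝟙*𝟙 (yes a) (yes b) (no ¬c) a→b→c = ⊥-elim (¬c (a→b→c a b))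
𝟙*𝟙≤𝟙*𝟙 (yes _) (no _)  _       _   = z≤n
𝟙*𝟙≤𝟙*𝟙 (no _)  _       _       _   = z≤n

∑-mono : ∀ {k} {f g : Fin k → ℕ} → (∀ i → f i ≤ g i) → sum f ≤ sum g
∑-mono {zero}  _   = z≤n
∑-mono {suc k} f≤g = +-mono-≤ (f≤g zero) (∑-mono (f≤g ∘ suc))

∑-const : ∀ k c → sum {k} (λ _ → c) ≡ k * c
∑-const zero    c = refl
∑-const (suc k) c = cong (c +_) (∑-const k c)

∑-nonzero : ∀ {k} (f : Fin k → ℕ) → sum f ≢ 0 → Σ (Fin k) λ i → f i ≢ 0
∑-nonzero {zero}  f ≢0 = ⊥-elim (≢0 refl)
∑-nonzero {suc k} f ≢0 with f zero ≟ 0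
... | no f₀≢0 = zero , f₀≢0
... | yes f₀≡0 with ∑-nonzero (f ∘ suc) (λ ≡0 → ≢0 (cong₂ _+_ f₀≡0 ≡0))
...   | i , fᵢ≢0 = suc i , fᵢ≢0

∑-zero : ∀ {k} {f : Fin k → ℕ} → (∀ i → f i ≡ 0) → sum f ≡ 0
∑-zero {k} f≡0 = trans (sum-cong-≗ f≡0) (trans (∑-const k 0) (*-zeroʳ k))

∑-𝟙-≟ : ∀ {k} (j : Fin k) → sum (λ i → 𝟙 (i ≟ᶠ j)) ≡ 1
∑-𝟙-≟ {suc k} zero = cong suc (∑-zero {k} (λ i → 𝟙-no (suc i ≟ᶠ zero) λ ()))
∑-𝟙-≟ {suc k} (suc j) = cong₂ _+_ (𝟙-no (zero ≟ᶠ suc j) λ ())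
  (trans (sum-cong-≗ λ i → 𝟙-cong (suc i ≟ᶠ suc j) (i ≟ᶠ j) suc-injective (cong suc)) (∑-𝟙-≟ j))

∑-𝟙-unique : ∀ {k} {P : Fin k → Set} (P? : ∀ i → Dec (P i)) →
             (∀ i j → P i → P j → i ≡ j) → sum (λ i → 𝟙 (P? i)) ≤ 1
∑-𝟙-unique P? unique with any? P?
... | yes (j , Pj) = ≤-reflexive (trans
        (sum-cong-≗ λ i → 𝟙-cong (P? i) (i ≟ᶠ j) (λ Pi → unique i j Pi Pj) λ { refl → Pj })
        (∑-𝟙-≟ j))
... | no ∄ = ≤-trans (≤-reflexive (∑-zero λ i → 𝟙-no (P? i) λ Pi → ∄ (i , Pi))) z≤n

𝟙-∈-∷ : ∀ {k} b (s : Subset k) i → 𝟙 (suc i ∈? (b ∷ s)) ≡ 𝟙 (i ∈? s)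
𝟙-∈-∷ b s i = 𝟙-cong (suc i ∈? (b ∷ s)) (i ∈? s) drop-there there

∑-𝟙-∈ : ∀ {k} (s : Subset k) → sum (λ i → 𝟙 (i ∈? s)) ≡ ∣ s ∣
∑-𝟙-∈ []          = refl
∑-𝟙-∈ (true ∷ s)  = cong suc (trans (sum-cong-≗ (𝟙-∈-∷ true s)) (∑-𝟙-∈ s))
∑-𝟙-∈ (false ∷ s) = trans (sum-cong-≗ (𝟙-∈-∷ false s)) (∑-𝟙-∈ s)

-- Sums over vectors

∑ⱽ : ∀ {q} n → (Vec (Fin q) n → ℕ) → ℕ
∑ⱽ zero    f = f []
∑ⱽ (suc n) f = sum λ x → ∑ⱽ n (λ xs → f (x ∷ xs))

module _ {q : ℕ} where

  ∑ⱽ-cong : ∀ n {f g : Vec (Fin q) n → ℕ} → (∀ v → f v ≡ g v) → ∑ⱽ n f ≡ ∑ⱽ n g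
  ∑ⱽ-cong zero    f≗g = f≗g []
  ∑ⱽ-cong (suc n) f≗g = sum-cong-≗ λ x → ∑ⱽ-cong n (f≗g ∘ (x ∷_))

  ∑ⱽ-mono : ∀ n {f g : Vec (Fin q) n → ℕ} → (∀ v → f v ≤ g v) → ∑ⱽ n f ≤ ∑ⱽ n g
  ∑ⱽ-mono zero    f≤g = f≤g []
  ∑ⱽ-mono (suc n) f≤g = ∑-mono λ x → ∑ⱽ-mono n (f≤g ∘ (x ∷_))

  ∑ⱽ-distrib-+ : ∀ n (f g : Vec (Fin q) n → ℕ) → ∑ⱽ n (λ v → f v + g v) ≡ ∑ⱽ n f + ∑ⱽ n g
  ∑ⱽ-distrib-+ zero    f g = refl
  ∑ⱽ-distrib-+ (suc n) f g =
    trans (sum-cong-≗ λ x → ∑ⱽ-distrib-+ n (f ∘ (x ∷_)) (g ∘ (x ∷_)))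
          (∑-distrib-+ (λ x → ∑ⱽ n (f ∘ (x ∷_))) (λ x → ∑ⱽ n (g ∘ (x ∷_))))

  *-distribˡ-∑ⱽ : ∀ n c (f : Vec (Fin q) n → ℕ) → c * ∑ⱽ n f ≡ ∑ⱽ n (λ v → c * f v)
  *-distribˡ-∑ⱽ zero    c f = refl
  *-distribˡ-∑ⱽ (suc n) c f =
    trans (*-distribˡ-sum c (λ x → ∑ⱽ n (f ∘ (x ∷_)))) (sum-cong-≗ λ x → *-distribˡ-∑ⱽ n c (f ∘ (x ∷_)))

  *-distribʳ-∑ⱽ : ∀ n c (f : Vec (Fin q) n → ℕ) → ∑ⱽ n f * c ≡ ∑ⱽ n (λ v → f v * c)
  *-distribʳ-∑ⱽ zero    c f = refl
  *-distribʳ-∑ⱽ (suc n) c f =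
    trans (*-distribʳ-sum c (λ x → ∑ⱽ n (f ∘ (x ∷_)))) (sum-cong-≗ λ x → *-distribʳ-∑ⱽ n c (f ∘ (x ∷_)))

  ∑ⱽ-const : ∀ n c → ∑ⱽ {q} n (λ _ → c) ≡ q ^ n * c
  ∑ⱽ-const zero    c = sym (+-identityʳ c)
  ∑ⱽ-const (suc n) c = begin
    sum {q} (λ _ → ∑ⱽ {q} n (λ _ → c)) ≡⟨ cong (λ t → sum {q} (λ _ → t)) (∑ⱽ-const n c) ⟩
    sum {q} (λ _ → q ^ n * c)      ≡⟨ ∑-const q (q ^ n * c) ⟩
    q * (q ^ n * c)            ≡⟨ *-assoc q (q ^ n) c ⟨
    q * q ^ n * c              ∎
    where open ≡-Reasoning

  ∑ⱽ-comm-sum : ∀ n {k} (f : Vec (Fin q) n → Fin k → ℕ) →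
                ∑ⱽ n (λ v → sum (f v)) ≡ sum (λ j → ∑ⱽ n (λ v → f v j))
  ∑ⱽ-comm-sum zero    f = refl
  ∑ⱽ-comm-sum (suc n) f =
    trans (sum-cong-≗ λ x → ∑ⱽ-comm-sum n (f ∘ (x ∷_))) (∑-comm λ x j → ∑ⱽ n (λ xs → f (x ∷ xs) j))

  ∑ⱽ-comm : ∀ n m (f : Vec (Fin q) n → Vec (Fin q) m → ℕ) →
            ∑ⱽ n (λ u → ∑ⱽ m (f u)) ≡ ∑ⱽ m (λ v → ∑ⱽ n (λ u → f u v))
  ∑ⱽ-comm zero    m f = refl
  ∑ⱽ-comm (suc n) m f =
    trans (sum-cong-≗ λ x → ∑ⱽ-comm n m (f ∘ (x ∷_))) (sym (∑ⱽ-comm-sum m λ v x → ∑ⱽ n (λ u → f (x ∷ u) v)))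

  ∑ⱽ-nonzero : ∀ n (f : Vec (Fin q) n → ℕ) → ∑ⱽ n f ≢ 0 → Σ (Vec (Fin q) n) λ v → f v ≢ 0
  ∑ⱽ-nonzero zero    f ≢0 = [] , ≢0
  ∑ⱽ-nonzero (suc n) f ≢0 with ∑-nonzero _ ≢0
  ... | x , ≢0′ with ∑ⱽ-nonzero n (f ∘ (x ∷_)) ≢0′
  ...   | xs , f≢0 = x ∷ xs , f≢0

  _≟ⱽ_ : ∀ {n} (u v : Vec (Fin q) n) → Dec (u ≡ v)
  _≟ⱽ_ = ≡-decᵛ _≟ᶠ_

  ∑ⱽ-𝟙-≟ : ∀ n (v₀ : Vec (Fin q) n) → ∑ⱽ n (λ v → 𝟙 (v ≟ⱽ v₀)) ≡ 1
  ∑ⱽ-𝟙-≟ zero    []        = refl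
  ∑ⱽ-𝟙-≟ (suc n) (x₀ ∷ v₀) = begin
    sum (λ x → ∑ⱽ n (λ v → 𝟙 ((x ∷ v) ≟ⱽ (x₀ ∷ v₀)))) ≡⟨ sum-cong-≗ head-term ⟩
    sum (λ x → 𝟙 (x ≟ᶠ x₀) * 1)                       ≡⟨ *-distribʳ-sum 1 (λ x → 𝟙 (x ≟ᶠ x₀)) ⟨
    sum (λ x → 𝟙 (x ≟ᶠ x₀)) * 1                       ≡⟨ cong (_* 1) (∑-𝟙-≟ x₀) ⟩
    1                                                 ∎
    where
    open ≡-Reasoning
    head-term : ∀ x → ∑ⱽ n (λ v → 𝟙 ((x ∷ v) ≟ⱽ (x₀ ∷ v₀))) ≡ 𝟙 (x ≟ᶠ x₀) * 1
    head-term x = by-cases (x ≟ᶠ x₀)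
      where
      by-cases : (x≟x₀ : Dec (x ≡ x₀)) → ∑ⱽ n (λ v → 𝟙 ((x ∷ v) ≟ⱽ (x₀ ∷ v₀))) ≡ 𝟙 x≟x₀ * 1
      by-cases (yes refl) = trans (∑ⱽ-cong n λ v → 𝟙-cong ((x ∷ v) ≟ⱽ (x ∷ v₀)) (v ≟ⱽ v₀)
                                                      (proj₂ ∘ ∷-injective) (cong (x ∷_)))
                                  (∑ⱽ-𝟙-≟ n v₀)
      by-cases (no x≢x₀)  = trans (∑ⱽ-cong n λ v → 𝟙-no ((x ∷ v) ≟ⱽ (x₀ ∷ v₀)) (x≢x₀ ∘ proj₁ ∘ ∷-injective))
                                  (trans (∑ⱽ-const n 0) (*-zeroʳ (q ^ n)))

_∈ᵇ_ : ∀ {q n} → Vec (Fin q) n → (Fin n → Subset q) → Set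
v ∈ᵇ S = ∀ i → lookup v i ∈ S i

_∈ᵇ?_ : ∀ {q n} (v : Vec (Fin q) n) (S : Fin n → Subset q) → Dec (v ∈ᵇ S)
v ∈ᵇ? S = all? λ i → lookup v i ∈? S i

𝟙-×-dec : {A B : Set} (a? : Dec A) (b? : Dec B) → 𝟙 (a? ×-dec b?) ≡ 𝟙 a? * 𝟙 b?
𝟙-×-dec (yes _) (yes _) = refl
𝟙-×-dec (yes _) (no _)  = refl
𝟙-×-dec (no _)  _       = refl

𝟙-∷-∈ᵇ : ∀ {q n} x (v : Vec (Fin q) n) (S : Fin (suc n) → Subset q) →
         𝟙 ((x ∷ v) ∈ᵇ? S) ≡ 𝟙 (x ∈? S zero) * 𝟙 (v ∈ᵇ? (S ∘ suc))
𝟙-∷-∈ᵇ x v S = trans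
  (𝟙-cong ((x ∷ v) ∈ᵇ? S) ((x ∈? S zero) ×-dec (v ∈ᵇ? (S ∘ suc)))
          (λ x∷v∈S → x∷v∈S zero , x∷v∈S ∘ suc)
          (λ { (x∈S₀ , v∈S) zero → x∈S₀ ; (x∈S₀ , v∈S) (suc i) → v∈S i }))
  (𝟙-×-dec (x ∈? S zero) (v ∈ᵇ? (S ∘ suc)))

prodFin-* : ∀ n (f g : Fin n → ℕ) → prodFin n (λ i → f i * g i) ≡ prodFin n f * prodFin n g
prodFin-* zero    f g = refl
prodFin-* (suc n) f g = trans (cong (f zero * g zero *_) (prodFin-* n (f ∘ suc) (g ∘ suc)))
                              (interchange (f zero) (g zero) (prodFin n (f ∘ suc)) (prodFin n (g ∘ suc)))
  where
  interchange : ∀ a b c e → (a * b) * (c * e) ≡ (a * c) * (b * e)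
  interchange = solve-∀

∑ⱽ-𝟙-∈ᵇ : ∀ {q} n (S : Fin n → Subset q) → ∑ⱽ n (λ v → 𝟙 (v ∈ᵇ? S)) ≡ prodFin n (λ i → ∣ S i ∣)
∑ⱽ-𝟙-∈ᵇ zero    S = refl
∑ⱽ-𝟙-∈ᵇ (suc n) S = begin
  sum (λ x → ∑ⱽ n (λ v → 𝟙 ((x ∷ v) ∈ᵇ? S)))
    ≡⟨ sum-cong-≗ (λ x → ∑ⱽ-cong n (λ v → 𝟙-∷-∈ᵇ x v S)) ⟩
  sum (λ x → ∑ⱽ n (λ v → 𝟙 (x ∈? S zero) * 𝟙 (v ∈ᵇ? (S ∘ suc))))
    ≡⟨ sum-cong-≗ (λ x → *-distribˡ-∑ⱽ n (𝟙 (x ∈? S zero)) _) ⟨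
  sum (λ x → 𝟙 (x ∈? S zero) * ∑ⱽ n (λ v → 𝟙 (v ∈ᵇ? (S ∘ suc))))
    ≡⟨ *-distribʳ-sum (∑ⱽ n (λ v → 𝟙 (v ∈ᵇ? (S ∘ suc)))) (λ x → 𝟙 (x ∈? S zero)) ⟨
  sum (λ x → 𝟙 (x ∈? S zero)) * ∑ⱽ n (λ v → 𝟙 (v ∈ᵇ? (S ∘ suc)))
    ≡⟨ cong₂ _*_ (∑-𝟙-∈ (S zero)) (∑ⱽ-𝟙-∈ᵇ n (S ∘ suc)) ⟩
  prodFin (suc n) (λ i → ∣ S i ∣) ∎
  where open ≡-Reasoning

-- Cauchy–Schwarz

2ab≤a²+b² : ∀ a b → 2 * (a * b) ≤ a * a + b * b
2ab≤a²+b² a b = [ ordered , flipped ]′ (≤-total a b)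
  where
  square-gap : ∀ a d → 2 * (a * (a + d)) + d * d ≡ a * a + (a + d) * (a + d)
  square-gap = solve-∀
  ordered : ∀ {a b} → a ≤ b → 2 * (a * b) ≤ a * a + b * b
  ordered {a} a≤b with m≤n⇒∃[o]m+o≡n a≤b
  ... | d , refl = ≤-trans (m≤m+n _ (d * d)) (≤-reflexive (square-gap a d))
  flipped : b ≤ a → 2 * (a * b) ≤ a * a + b * b
  flipped b≤a = subst₂ _≤_ (cong (2 *_) (*-comm b a)) (+-comm (b * b) (a * a)) (ordered b≤a)

∑ⱽ-*-∑ⱽ : ∀ {q} n m (f : Vec (Fin q) n → ℕ) (g : Vec (Fin q) m → ℕ) →
          ∑ⱽ n f * ∑ⱽ m g ≡ ∑ⱽ n (λ u → ∑ⱽ m (λ v → f u * g v))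
∑ⱽ-*-∑ⱽ n m f g = trans (*-distribʳ-∑ⱽ n (∑ⱽ m g) f) (∑ⱽ-cong n λ u → *-distribˡ-∑ⱽ m (f u) g)

∑ⱽ-cauchy-schwarz : ∀ {q} n (w x : Vec (Fin q) n → ℕ) →
  ∑ⱽ n (λ v → w v * x v) * ∑ⱽ n (λ v → w v * x v) ≤ ∑ⱽ n w * ∑ⱽ n (λ v → w v * (x v * x v))
∑ⱽ-cauchy-schwarz n w x = *-cancelˡ-≤ 2 (begin
  2 * (S * S)
    ≡⟨ cong (2 *_) (∑ⱽ-*-∑ⱽ n n wx wx) ⟩
  2 * ∑ⱽ n (λ u → ∑ⱽ n (λ v → wx u * wx v))
    ≡⟨ *-distribˡ-∑ⱽ n 2 _ ⟩
  ∑ⱽ n (λ u → 2 * ∑ⱽ n (λ v → wx u * wx v))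
    ≡⟨ ∑ⱽ-cong n (λ u → *-distribˡ-∑ⱽ n 2 _) ⟩
  ∑ⱽ n (λ u → ∑ⱽ n (λ v → 2 * (wx u * wx v)))
    ≤⟨ ∑ⱽ-mono n (λ u → ∑ⱽ-mono n (pointwise u)) ⟩
  ∑ⱽ n (λ u → ∑ⱽ n (λ v → w u * wxx v + wxx u * w v))
    ≡⟨ ∑ⱽ-cong n (λ u → ∑ⱽ-distrib-+ n _ _) ⟩
  ∑ⱽ n (λ u → ∑ⱽ n (λ v → w u * wxx v) + ∑ⱽ n (λ v → wxx u * w v))
    ≡⟨ ∑ⱽ-distrib-+ n _ _ ⟩
  ∑ⱽ n (λ u → ∑ⱽ n (λ v → w u * wxx v)) + ∑ⱽ n (λ u → ∑ⱽ n (λ v → wxx u * w v))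
    ≡⟨ cong₂ _+_ (∑ⱽ-*-∑ⱽ n n w wxx) (∑ⱽ-*-∑ⱽ n n wxx w) ⟨
  W * C + C * W
    ≡⟨ cong (W * C +_) (*-comm C W) ⟩
  W * C + W * C
    ≡⟨ cong (W * C +_) (+-identityʳ (W * C)) ⟨
  2 * (W * C) ∎)
  where
  open ≤-Reasoning
  wx wxx : _ → ℕ
  wx v = w v * x v
  wxx v = w v * (x v * x v)
  S = ∑ⱽ n wx
  W = ∑ⱽ n w
  C = ∑ⱽ n wxx
  rearrange : ∀ wu wv xu xv → 2 * ((wu * xu) * (wv * xv)) ≡ (wu * wv) * (2 * (xu * xv))
  rearrange = solve-∀
  rearrange′ : ∀ wu wv xu xv → (wu * wv) * (xu * xu + xv * xv) ≡ wu * (wv * (xv * xv)) + (wu * (xu * xu)) * wv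
  rearrange′ = solve-∀
  pointwise : ∀ u v → 2 * (wx u * wx v) ≤ w u * wxx v + wxx u * w v
  pointwise u v = begin
    2 * (wx u * wx v)                    ≡⟨ rearrange (w u) (w v) (x u) (x v) ⟩
    (w u * w v) * (2 * (x u * x v))      ≤⟨ *-monoʳ-≤ (w u * w v) (2ab≤a²+b² (x u) (x v)) ⟩
    (w u * w v) * (x u * x u + x v * x v) ≡⟨ rearrange′ (w u) (w v) (x u) (x v) ⟩
    w u * wxx v + wxx u * w v ∎

-- Dividing the second-moment bound by P μ gives P q D ≤ N (q + P) with D = q μ;
-- substituting N = q D − H leaves H (q + P) ≤ q² D.
product-bound : ∀ {q μ P N H} → 0 < μ →
  (P * (q * μ)) * (P * (q * μ)) ≤ N * (P * (q * μ) + P * P * μ) →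
  N + H ≡ q * (q * μ) → H * P ≤ q * (q * (q * μ))
product-bound {P = zero} {H = H} _ _ _ = ≤-trans (≤-reflexive (*-zeroʳ H)) z≤n
product-bound {q} {μ} {P@(suc _)} {N} {H} μ>0 second-moment N+H≡q²μ =
  ≤-trans (*-monoʳ-≤ H (m≤n+m P q)) (+-cancelʳ-≤ (P * qD) _ _ (begin
    H * (q + P) + P * qD ≤⟨ +-monoʳ-≤ (H * (q + P)) P*qD≤N*[q+P] ⟩
    H * (q + P) + N * (q + P) ≡⟨ *-distribʳ-+ (q + P) H N ⟨
    (H + N) * (q + P)         ≡⟨ cong (_* (q + P)) (trans (+-comm H N) N+H≡q²μ) ⟩
    qD * (q + P)              ≡⟨ *-distribˡ-+ qD q P ⟩
    qD * q + qD * P           ≡⟨ cong₂ _+_ (*-comm qD q) (*-comm qD P) ⟩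
    q * qD + P * qD           ∎))
  where
  open ≤-Reasoning
  D = q * μ
  qD = q * D
  instance
    Pμ≢0 : NonZero (P * μ)
    Pμ≢0 = >-nonZero (*-mono-< {0} {P} {0} {μ} (s≤s z≤n) μ>0)
  P*qD≤N*[q+P] : P * qD ≤ N * (q + P)
  P*qD≤N*[q+P] = *-cancelˡ-≤ (P * μ) (begin
    P * μ * (P * qD)      ≡⟨ lhs P q μ ⟩
    (P * D) * (P * D)      ≤⟨ second-moment ⟩
    N * (P * D + P * P * μ) ≡⟨ rhs P q μ N ⟩
    P * μ * (N * (q + P)) ∎)
    where
    lhs : ∀ P q μ → P * μ * (P * (q * (q * μ))) ≡ (P * (q * μ)) * (P * (q * μ))
    lhs = solve-∀
    rhs : ∀ P q μ N → N * (P * (q * μ) + P * P * μ) ≡ P * μ * (N * (q + P))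
    rhs = solve-∀

module SecondMoment {q d : ℕ} (I : Vec (Fin q) d → Vec (Fin q) d → ℕ) (D μ : ℕ)
  (degree : ∀ p → ∑ⱽ d (I p) ≡ D)
  (codegree : ∀ p p′ → ∑ⱽ d (λ h → I p h * I p′ h) ≤ 𝟙 (p′ ≟ⱽ p) * D + μ)
  {P : Vec (Fin q) d → Set} (P? : ∀ p → Dec (P p)) where

  𝟙P : Vec (Fin q) d → ℕ
  𝟙P p = 𝟙 (P? p)

  ∣P∣ : ℕ
  ∣P∣ = ∑ⱽ d 𝟙P

  pointsOn : Vec (Fin q) d → ℕ
  pointsOn h = ∑ⱽ d (λ p → 𝟙P p * I p h)

  ∑-pointsOn : ∑ⱽ d pointsOn ≡ ∣P∣ * D
  ∑-pointsOn = begin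
    ∑ⱽ d (λ h → ∑ⱽ d (λ p → 𝟙P p * I p h)) ≡⟨ ∑ⱽ-comm d d (λ h p → 𝟙P p * I p h) ⟩
    ∑ⱽ d (λ p → ∑ⱽ d (λ h → 𝟙P p * I p h)) ≡⟨ ∑ⱽ-cong d (λ p → *-distribˡ-∑ⱽ d (𝟙P p) (I p)) ⟨
    ∑ⱽ d (λ p → 𝟙P p * ∑ⱽ d (I p))         ≡⟨ ∑ⱽ-cong d (λ p → cong (𝟙P p *_) (degree p)) ⟩
    ∑ⱽ d (λ p → 𝟙P p * D)                  ≡⟨ *-distribʳ-∑ⱽ d D 𝟙P ⟨
    ∣P∣ * D                                 ∎
    where open ≡-Reasoning

  pair-bound : ∀ p p′ → ∑ⱽ d (λ h → (𝟙P p * I p h) * (𝟙P p′ * I p′ h))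
                        ≤ 𝟙P p * (𝟙 (p′ ≟ⱽ p) * D) + 𝟙P p * 𝟙P p′ * μ
  pair-bound p p′ = begin
    ∑ⱽ d (λ h → (𝟙P p * I p h) * (𝟙P p′ * I p′ h))
      ≡⟨ ∑ⱽ-cong d (λ h → interchange (𝟙P p) (I p h) (𝟙P p′) (I p′ h)) ⟩
    ∑ⱽ d (λ h → (𝟙P p * 𝟙P p′) * (I p h * I p′ h))
      ≡⟨ *-distribˡ-∑ⱽ d (𝟙P p * 𝟙P p′) (λ h → I p h * I p′ h) ⟨
    (𝟙P p * 𝟙P p′) * ∑ⱽ d (λ h → I p h * I p′ h)
      ≤⟨ *-monoʳ-≤ (𝟙P p * 𝟙P p′) (codegree p p′) ⟩
    (𝟙P p * 𝟙P p′) * (δ * D + μ)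
      ≡⟨ expand (𝟙P p) (𝟙P p′) δ D μ ⟩
    𝟙P p′ * (𝟙P p * (δ * D)) + 𝟙P p * 𝟙P p′ * μ
      ≤⟨ +-monoˡ-≤ (𝟙P p * 𝟙P p′ * μ) (*-monoˡ-≤ (𝟙P p * (δ * D)) (𝟙≤1 (P? p′))) ⟩
    1 * (𝟙P p * (δ * D)) + 𝟙P p * 𝟙P p′ * μ
      ≡⟨ cong (_+ 𝟙P p * 𝟙P p′ * μ) (*-identityˡ (𝟙P p * (δ * D))) ⟩
    𝟙P p * (δ * D) + 𝟙P p * 𝟙P p′ * μ ∎
    where
    open ≤-Reasoning
    δ = 𝟙 (p′ ≟ⱽ p)
    interchange : ∀ a b c e → (a * b) * (c * e) ≡ (a * c) * (b * e)
    interchange = solve-∀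
    expand : ∀ a a′ δ D μ → (a * a′) * (δ * D + μ) ≡ a′ * (a * (δ * D)) + a * a′ * μ
    expand = solve-∀

  row-sum : ∀ p → ∑ⱽ d (λ p′ → 𝟙P p * (𝟙 (p′ ≟ⱽ p) * D) + 𝟙P p * 𝟙P p′ * μ)
                    ≡ 𝟙P p * D + 𝟙P p * ∣P∣ * μ
  row-sum p = begin
    ∑ⱽ d (λ p′ → 𝟙P p * (𝟙 (p′ ≟ⱽ p) * D) + 𝟙P p * 𝟙P p′ * μ)
      ≡⟨ ∑ⱽ-distrib-+ d _ _ ⟩
    ∑ⱽ d (λ p′ → 𝟙P p * (𝟙 (p′ ≟ⱽ p) * D)) + ∑ⱽ d (λ p′ → 𝟙P p * 𝟙P p′ * μ)
      ≡⟨ cong₂ _+_ diagonal (*-distribʳ-∑ⱽ d μ (λ p′ → 𝟙P p * 𝟙P p′)) ⟨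
    𝟙P p * D + ∑ⱽ d (λ p′ → 𝟙P p * 𝟙P p′) * μ
      ≡⟨ cong (λ t → 𝟙P p * D + t * μ) (*-distribˡ-∑ⱽ d (𝟙P p) 𝟙P) ⟨
    𝟙P p * D + 𝟙P p * ∣P∣ * μ ∎
    where
    open ≡-Reasoning
    diagonal : 𝟙P p * D ≡ ∑ⱽ d (λ p′ → 𝟙P p * (𝟙 (p′ ≟ⱽ p) * D))
    diagonal = begin
      𝟙P p * D                               ≡⟨ cong (𝟙P p *_) (*-identityˡ D) ⟨
      𝟙P p * (1 * D)                         ≡⟨ cong (λ t → 𝟙P p * (t * D)) (∑ⱽ-𝟙-≟ d p) ⟨
      𝟙P p * (∑ⱽ d (λ p′ → 𝟙 (p′ ≟ⱽ p)) * D) ≡⟨ cong (𝟙P p *_) (*-distribʳ-∑ⱽ d D _) ⟩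
      𝟙P p * ∑ⱽ d (λ p′ → 𝟙 (p′ ≟ⱽ p) * D)   ≡⟨ *-distribˡ-∑ⱽ d (𝟙P p) _ ⟩
      ∑ⱽ d (λ p′ → 𝟙P p * (𝟙 (p′ ≟ⱽ p) * D)) ∎

  ∑-pointsOn² : ∑ⱽ d (λ h → pointsOn h * pointsOn h) ≤ ∣P∣ * D + ∣P∣ * ∣P∣ * μ
  ∑-pointsOn² = begin
    ∑ⱽ d (λ h → pointsOn h * pointsOn h)
      ≡⟨ ∑ⱽ-cong d (λ h → ∑ⱽ-*-∑ⱽ d d (λ p → 𝟙P p * I p h) (λ p′ → 𝟙P p′ * I p′ h)) ⟩
    ∑ⱽ d (λ h → ∑ⱽ d (λ p → ∑ⱽ d (λ p′ → term p p′ h)))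
      ≡⟨ ∑ⱽ-comm d d (λ h p → ∑ⱽ d (λ p′ → term p p′ h)) ⟩
    ∑ⱽ d (λ p → ∑ⱽ d (λ h → ∑ⱽ d (λ p′ → term p p′ h)))
      ≡⟨ ∑ⱽ-cong d (λ p → ∑ⱽ-comm d d (λ h p′ → term p p′ h)) ⟩
    ∑ⱽ d (λ p → ∑ⱽ d (λ p′ → ∑ⱽ d (term p p′)))
      ≤⟨ ∑ⱽ-mono d (λ p → ∑ⱽ-mono d (pair-bound p)) ⟩
    ∑ⱽ d (λ p → ∑ⱽ d (λ p′ → 𝟙P p * (𝟙 (p′ ≟ⱽ p) * D) + 𝟙P p * 𝟙P p′ * μ))
      ≡⟨ ∑ⱽ-cong d row-sum ⟩
    ∑ⱽ d (λ p → 𝟙P p * D + 𝟙P p * ∣P∣ * μ)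
      ≡⟨ ∑ⱽ-distrib-+ d _ _ ⟩
    ∑ⱽ d (λ p → 𝟙P p * D) + ∑ⱽ d (λ p → 𝟙P p * ∣P∣ * μ)
      ≡⟨ cong₂ _+_ (*-distribʳ-∑ⱽ d D 𝟙P)
                   (trans (cong (_* μ) (*-distribʳ-∑ⱽ d ∣P∣ 𝟙P)) (*-distribʳ-∑ⱽ d μ _)) ⟨
    ∣P∣ * D + ∣P∣ * ∣P∣ * μ ∎
    where
    open ≤-Reasoning
    term : _ → _ → _ → ℕ
    term p p′ h = (𝟙P p * I p h) * (𝟙P p′ * I p′ h)

  module _ {H : Vec (Fin q) d → Set} (H? : ∀ h → Dec (H h)) where

    𝟙H 𝟙∁H : Vec (Fin q) d → ℕ
    𝟙H h = 𝟙 (H? h)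
    𝟙∁H h = 1 ∸ 𝟙H h

    incidences : ℕ
    incidences = ∑ⱽ d (λ h → 𝟙H h * pointsOn h)

    ∣∁H∣+∣H∣ : ∑ⱽ d 𝟙∁H + ∑ⱽ d 𝟙H ≡ q ^ d
    ∣∁H∣+∣H∣ = begin
      ∑ⱽ d 𝟙∁H + ∑ⱽ d 𝟙H          ≡⟨ ∑ⱽ-distrib-+ d 𝟙∁H 𝟙H ⟨
      ∑ⱽ d (λ h → 𝟙∁H h + 𝟙H h) ≡⟨ ∑ⱽ-cong d (λ h → m∸n+n≡m (𝟙≤1 (H? h))) ⟩
      ∑ⱽ d (λ _ → 1)             ≡⟨ ∑ⱽ-const d 1 ⟩
      q ^ d * 1                  ≡⟨ *-identityʳ (q ^ d) ⟩
      q ^ d                      ∎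
      where open ≡-Reasoning

    incidence-free : incidences ≡ 0 →
      (∣P∣ * D) * (∣P∣ * D) ≤ ∑ⱽ d 𝟙∁H * (∣P∣ * D + ∣P∣ * ∣P∣ * μ)
    incidence-free no-incidence = begin
      (∣P∣ * D) * (∣P∣ * D) ≡⟨ cong₂ _*_ off-H off-H ⟩
      S * S                 ≤⟨ ∑ⱽ-cauchy-schwarz d 𝟙∁H pointsOn ⟩
      ∑ⱽ d 𝟙∁H * ∑ⱽ d (λ h → 𝟙∁H h * (pointsOn h * pointsOn h))
        ≤⟨ *-monoʳ-≤ (∑ⱽ d 𝟙∁H) (∑ⱽ-mono d λ h → *-monoˡ-≤ (pointsOn h * pointsOn h) (m∸n≤m 1 (𝟙H h))) ⟩
      ∑ⱽ d 𝟙∁H * ∑ⱽ d (λ h → 1 * (pointsOn h * pointsOn h))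
        ≡⟨ cong (∑ⱽ d 𝟙∁H *_) (∑ⱽ-cong d λ h → *-identityˡ (pointsOn h * pointsOn h)) ⟩
      ∑ⱽ d 𝟙∁H * ∑ⱽ d (λ h → pointsOn h * pointsOn h)
        ≤⟨ *-monoʳ-≤ (∑ⱽ d 𝟙∁H) ∑-pointsOn² ⟩
      ∑ⱽ d 𝟙∁H * (∣P∣ * D + ∣P∣ * ∣P∣ * μ) ∎
      where
      open ≤-Reasoning
      S = ∑ⱽ d (λ h → 𝟙∁H h * pointsOn h)
      off-H : ∣P∣ * D ≡ S
      off-H = begin-equality
        ∣P∣ * D                                       ≡⟨ ∑-pointsOn ⟨
        ∑ⱽ d pointsOn                                 ≡⟨ ∑ⱽ-cong d (λ h → *-identityˡ (pointsOn h)) ⟨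
        ∑ⱽ d (λ h → 1 * pointsOn h)                   ≡⟨ ∑ⱽ-cong d (λ h → cong (_* pointsOn h) (m∸n+n≡m (𝟙≤1 (H? h)))) ⟨
        ∑ⱽ d (λ h → (𝟙∁H h + 𝟙H h) * pointsOn h)      ≡⟨ ∑ⱽ-cong d (λ h → *-distribʳ-+ (pointsOn h) (𝟙∁H h) (𝟙H h)) ⟩
        ∑ⱽ d (λ h → 𝟙∁H h * pointsOn h + 𝟙H h * pointsOn h) ≡⟨ ∑ⱽ-distrib-+ d _ _ ⟩
        S + incidences                                ≡⟨ cong (S +_) no-incidence ⟩
        S + 0                                         ≡⟨ +-identityʳ S ⟩
        S                                             ∎

    incidence-witness : incidences ≢ 0 →
      Σ (Vec (Fin q) d) λ p → Σ (Vec (Fin q) d) λ h → P p × H h × I p h ≢ 0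
    incidence-witness ≢0 with ∑ⱽ-nonzero d _ ≢0
    ... | h , ≢0′ with 𝟙*≢0⇒ (H? h) ≢0′
    ...   | h∈H , pointsOn≢0 with ∑ⱽ-nonzero d _ pointsOn≢0
    ...     | p , ≢0″ with 𝟙*≢0⇒ (P? p) ≢0″
    ...       | p∈P , I≢0 = p , h , p∈P , h∈H , I≢0

module QuasifieldProperties {q : ℕ} (Q : Quasifield q) where

  open Quasifield Q using (0#; distribˡ; unique-sol) renaming (_+_ to _⊕_; _*_ to _⊛_; -_ to ⊖_)

  +-isGroup : IsGroup _≡_ _⊕_ 0# ⊖_
  +-isGroup = record
    { isMonoid = record
      { isSemigroup = record
        { isMagma = record { isEquivalence = isEquivalence ; ∙-cong = cong₂ _⊕_ }
        ; assoc   = Quasifield.+-assoc Q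
        }
      ; identity = Quasifield.+-identityˡ Q , Quasifield.+-identityʳ Q
      }
    ; inverse = Quasifield.-‿inverseˡ Q , Quasifield.-‿inverseʳ Q
    ; ⁻¹-cong = cong ⊖_
    }

  +-group : Group 0ℓ 0ℓ
  +-group = record { isGroup = +-isGroup }

  open Group +-group public using (_\\_; _//_; assoc; identityˡ; identityʳ; inverseˡ)
  open GroupProperties +-group public

  ⊛-zeroʳ : ∀ a → a ⊛ 0# ≡ 0#
  ⊛-zeroʳ a = ∙-cancelˡ (a ⊛ 0#) (a ⊛ 0#) 0# (begin
    a ⊛ 0# ⊕ a ⊛ 0# ≡⟨ distribˡ a 0# 0# ⟨
    a ⊛ (0# ⊕ 0#)   ≡⟨ cong (a ⊛_) (identityˡ 0#) ⟩
    a ⊛ 0#          ≡⟨ identityʳ (a ⊛ 0#) ⟨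
    a ⊛ 0# ⊕ 0#     ∎)
    where open ≡-Reasoning

  ⊛-neg : ∀ a v → a ⊛ (⊖ v) ≡ ⊖ (a ⊛ v)
  ⊛-neg a v = inverseˡ-unique (a ⊛ (⊖ v)) (a ⊛ v) (begin
    a ⊛ (⊖ v) ⊕ a ⊛ v ≡⟨ distribˡ a (⊖ v) v ⟨
    a ⊛ (⊖ v ⊕ v)     ≡⟨ cong (a ⊛_) (inverseˡ v) ⟩
    a ⊛ 0#            ≡⟨ ⊛-zeroʳ a ⟩
    0#                ∎)
    where open ≡-Reasoning

  ∑-𝟙-⊕≟ : ∀ c w → sum (λ z → 𝟙 (z ⊕ c ≟ᶠ w)) ≡ 1
  ∑-𝟙-⊕≟ c w = trans
    (sum-cong-≗ λ z → 𝟙-cong (z ⊕ c ≟ᶠ w) (z ≟ᶠ w // c) (x≈z//y z c w) λ { refl → //-rightDividesˡ c w })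
    (∑-𝟙-≟ (w // c))

  -- unique-sol has its constant on the right; passing to −t moves it there, as (Q, ⊕) need
  -- not be commutative.
  distinct-slopes-meet-once : ∀ {x₁ x₂} α β {t t′} → x₁ ≢ x₂ →
    α ⊕ x₁ ⊛ t ≡ β ⊕ x₂ ⊛ t → α ⊕ x₁ ⊛ t′ ≡ β ⊕ x₂ ⊛ t′ → t ≡ t′
  distinct-slopes-meet-once {x₁} {x₂} α β {t} {t′} x₁≢x₂ meet meet′
    with unique-sol x₂ x₁ (⊖ (β \\ α)) (x₁≢x₂ ∘ sym)
  ... | _ , _ , unique =
    ⁻¹-injective (trans (unique (⊖ t) (⊖ t) (negated meet)) (sym (unique (⊖ t′) (⊖ t′) (negated meet′))))
    where
    open ≡-Reasoning
    negated : ∀ {s} → α ⊕ x₁ ⊛ s ≡ β ⊕ x₂ ⊛ s → x₂ ⊛ (⊖ s) ≡ x₁ ⊛ (⊖ s) ⊕ ⊖ (β \\ α)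
    negated {s} meets = begin
      x₂ ⊛ (⊖ s)                 ≡⟨ ⊛-neg x₂ s ⟩
      ⊖ (x₂ ⊛ s)                 ≡⟨ cong ⊖_ (\\-leftDividesʳ β (x₂ ⊛ s)) ⟨
      ⊖ (β \\ (β ⊕ x₂ ⊛ s))      ≡⟨ cong (λ r → ⊖ (β \\ r)) meets ⟨
      ⊖ (β \\ (α ⊕ x₁ ⊛ s))      ≡⟨ cong ⊖_ (assoc (⊖ β) α (x₁ ⊛ s)) ⟨
      ⊖ ((β \\ α) ⊕ x₁ ⊛ s)      ≡⟨ ⁻¹-anti-homo-∙ (β \\ α) (x₁ ⊛ s) ⟩
      ⊖ (x₁ ⊛ s) ⊕ ⊖ (β \\ α)    ≡⟨ cong (_⊕ ⊖ (β \\ α)) (⊛-neg x₁ s) ⟨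
      x₁ ⊛ (⊖ s) ⊕ ⊖ (β \\ α)    ∎

  dotL-⊕ : ∀ {k} c acc (u v : Vec (Fin q) k) → dotL Q (c ⊕ acc) u v ≡ c ⊕ dotL Q acc u v
  dotL-⊕ c acc []      []      = refl
  dotL-⊕ c acc (x ∷ u) (y ∷ v) =
    trans (cong (λ r → dotL Q r u v) (assoc c acc (x ⊛ y))) (dotL-⊕ c (acc ⊕ x ⊛ y) u v)

  ⊕-dot-∷ : ∀ {k} α x y (u v : Vec (Fin q) k) →
            α ⊕ dot Q (x ∷ u) (y ∷ v) ≡ (α ⊕ x ⊛ y) ⊕ dot Q u v
  ⊕-dot-∷ α x y u v = begin
    α ⊕ dotL Q (0# ⊕ x ⊛ y) u v      ≡⟨ cong (λ r → α ⊕ dotL Q r u v) (identityˡ (x ⊛ y)) ⟩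
    α ⊕ dotL Q (x ⊛ y) u v           ≡⟨ cong (λ r → α ⊕ dotL Q r u v) (identityʳ (x ⊛ y)) ⟨
    α ⊕ dotL Q (x ⊛ y ⊕ 0#) u v      ≡⟨ cong (α ⊕_) (dotL-⊕ (x ⊛ y) 0# u v) ⟩
    α ⊕ (x ⊛ y ⊕ dot Q u v)          ≡⟨ assoc α (x ⊛ y) (dot Q u v) ⟨
    (α ⊕ x ⊛ y) ⊕ dot Q u v          ∎
    where open ≡-Reasoning

  _\\ᵛ_ : ∀ {k} → Vec (Fin q) k → Vec (Fin q) k → Vec (Fin q) k
  _\\ᵛ_ = zipWith _\\_

  ⊕-\\ᵛ : ∀ {k} (u a : Vec (Fin q) k) → zipWith _⊕_ u (u \\ᵛ a) ≡ a
  ⊕-\\ᵛ []      []      = refl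
  ⊕-\\ᵛ (x ∷ u) (y ∷ a) = cong₂ _∷_ (\\-leftDividesˡ x y) (⊕-\\ᵛ u a)

  \\-∈-set : ∀ a {x} X → x ∈ _-set_ Q a X → x \\ a ∈ X
  \\-∈-set a {x} X x∈a-X with any? (λ x′ → (x′ ∈? X) ×-dec (x ≟ᶠ a ⊕ ⊖ x′)) | tabulated
    where
    tabulated : does (any? (λ x′ → (x′ ∈? X) ×-dec (x ≟ᶠ a ⊕ ⊖ x′))) ≡ true
    tabulated = trans (sym (lookup∘tabulate _ x)) ([]=⇒lookup x∈a-X)
  ... | yes (x′ , x′∈X , refl) | _ = subst (_∈ X) (sym (//\\-cancel a x′)) x′∈X
    where
    //\\-cancel : ∀ a x → (a // x) \\ a ≡ x
    //\\-cancel a x = trans (cong (_⊕ a) (⁻¹-anti-homo-// a x)) (//-rightDividesˡ a x)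
  ... | no _ | ()

  ∈ᵇ-∩-set : ∀ {k} (X : Fin k → Subset q) (a : Vec (Fin q) k) {u} →
              u ∈ᵇ (λ i → X i ∩ _-set_ Q (lookup a i) (X i)) → u ∈ᵇ X × (u \\ᵛ a) ∈ᵇ X
  ∈ᵇ-∩-set X a {u} u∈ = (λ i → p∩q⊆p (X i) _ (u∈ i))
                      , (λ i → subst (_∈ X i) (sym (lookup-zipWith _\\_ i u a))
                                     (\\-∈-set (lookup a i) (X i) (p∩q⊆q (X i) _ (u∈ i))))

  coincide : ∀ {k} → Fin q → Vec (Fin q) k → Fin q → Vec (Fin q) k → Vec (Fin q) k → ℕ
  coincide α u₁ β u₂ v = 𝟙 (α ⊕ dot Q u₁ v ≟ᶠ β ⊕ dot Q u₂ v)

  coincide-∷ : ∀ {k} α x₁ u₁ β x₂ u₂ t (v : Vec (Fin q) k) →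
    coincide α (x₁ ∷ u₁) β (x₂ ∷ u₂) (t ∷ v) ≡ coincide (α ⊕ x₁ ⊛ t) u₁ (β ⊕ x₂ ⊛ t) u₂ v
  coincide-∷ α x₁ u₁ β x₂ u₂ t v =
    cong₂ (λ l r → 𝟙 (l ≟ᶠ r)) (⊕-dot-∷ α x₁ t u₁ v) (⊕-dot-∷ β x₂ t u₂ v)

  -- If the tails of u₁, u₂ differ, recurse on them; otherwise their heads differ, and for
  -- each tail of y at most one head of y makes the two values coincide.
  hyperplane-count : ∀ {m} (b : Vec (Fin q) (suc m)) α β {u₁ u₂ : Vec (Fin q) (suc m)} → u₁ ≢ u₂ →
    ∑ⱽ (suc m) (λ y → coincide α u₁ β u₂ (y \\ᵛ b)) ≤ q ^ m
  hyperplane-count {m} (b₀ ∷ b) α β {x₁ ∷ u₁} {x₂ ∷ u₂} u≢u′ with u₁ ≟ⱽ u₂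
  hyperplane-count {zero} (b₀ ∷ []) α β {x₁ ∷ []} {x₂ ∷ []} u≢u′ | no []≢[] = ⊥-elim ([]≢[] refl)
  hyperplane-count {suc m} (b₀ ∷ b) α β {x₁ ∷ u₁} {x₂ ∷ u₂} u≢u′ | no u₁≢u₂ = begin
    sum (λ y₀ → ∑ⱽ (suc m) (λ y → coincide α (x₁ ∷ u₁) β (x₂ ∷ u₂) ((y₀ ∷ y) \\ᵛ (b₀ ∷ b))))
      ≡⟨ sum-cong-≗ (λ y₀ → ∑ⱽ-cong (suc m) λ y → coincide-∷ α x₁ u₁ β x₂ u₂ (y₀ \\ b₀) (y \\ᵛ b)) ⟩
    sum (λ y₀ → ∑ⱽ (suc m) (λ y → coincide (α ⊕ x₁ ⊛ (y₀ \\ b₀)) u₁ (β ⊕ x₂ ⊛ (y₀ \\ b₀)) u₂ (y \\ᵛ b)))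
      ≤⟨ ∑-mono (λ y₀ → hyperplane-count b (α ⊕ x₁ ⊛ (y₀ \\ b₀)) (β ⊕ x₂ ⊛ (y₀ \\ b₀)) u₁≢u₂) ⟩
    sum {q} (λ _ → q ^ m)
      ≡⟨ ∑-const q (q ^ m) ⟩
    q ^ suc m ∎
    where open ≤-Reasoning
  hyperplane-count {m} (b₀ ∷ b) α β {x₁ ∷ u} {x₂ ∷ u} u≢u′ | yes refl = begin
    sum (λ y₀ → ∑ⱽ m (λ y → coincide α (x₁ ∷ u) β (x₂ ∷ u) ((y₀ ∷ y) \\ᵛ (b₀ ∷ b))))
      ≡⟨ sum-cong-≗ (λ y₀ → ∑ⱽ-cong m λ y → coincide-∷ α x₁ u β x₂ u (y₀ \\ b₀) (y \\ᵛ b)) ⟩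
    sum (λ y₀ → ∑ⱽ m (λ y → coincide (α ⊕ x₁ ⊛ (y₀ \\ b₀)) u (β ⊕ x₂ ⊛ (y₀ \\ b₀)) u (y \\ᵛ b)))
      ≡⟨ ∑ⱽ-comm-sum m (λ y y₀ → coincide (α ⊕ x₁ ⊛ (y₀ \\ b₀)) u (β ⊕ x₂ ⊛ (y₀ \\ b₀)) u (y \\ᵛ b)) ⟨
    ∑ⱽ m (λ y → sum (λ y₀ → coincide (α ⊕ x₁ ⊛ (y₀ \\ b₀)) u (β ⊕ x₂ ⊛ (y₀ \\ b₀)) u (y \\ᵛ b)))
      ≤⟨ ∑ⱽ-mono m (λ y → ∑-𝟙-unique _ (λ y₀ y₀′ → first-coordinate-unique (y \\ᵛ b))) ⟩
    ∑ⱽ m (λ _ → 1)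
      ≡⟨ ∑ⱽ-const m 1 ⟩
    q ^ m * 1
      ≡⟨ *-identityʳ (q ^ m) ⟩
    q ^ m ∎
    where
    open ≤-Reasoning
    x₁≢x₂ : x₁ ≢ x₂
    x₁≢x₂ refl = u≢u′ refl
    first-coordinate-unique : ∀ {y₀ y₀′} v →
      (α ⊕ x₁ ⊛ (y₀ \\ b₀)) ⊕ dot Q u v ≡ (β ⊕ x₂ ⊛ (y₀ \\ b₀)) ⊕ dot Q u v →
      (α ⊕ x₁ ⊛ (y₀′ \\ b₀)) ⊕ dot Q u v ≡ (β ⊕ x₂ ⊛ (y₀′ \\ b₀)) ⊕ dot Q u v → y₀ ≡ y₀′
    first-coordinate-unique {y₀} {y₀′} v meet meet′ =
      ⁻¹-injective (∙-cancelʳ b₀ (⊖ y₀) (⊖ y₀′) (distinct-slopes-meet-once α β x₁≢x₂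
        (∙-cancelʳ (dot Q u v) _ _ meet) (∙-cancelʳ (dot Q u v) _ _ meet′)))

module Incidence {q : ℕ} (Q : Quasifield q) {m : ℕ} (b : Vec (Fin q) (suc m)) (w : Fin q) where

  open Quasifield Q using () renaming (_+_ to _⊕_)
  open QuasifieldProperties Q

  n : ℕ
  n = suc m

  Incident : Vec (Fin q) (suc n) → Vec (Fin q) (suc n) → Set
  Incident (z′ ∷ u) (z ∷ y) = (z ⊕ z′) ⊕ dot Q u (y \\ᵛ b) ≡ w

  incident? : ∀ p h → Dec (Incident p h)
  incident? (z′ ∷ u) (z ∷ y) = (z ⊕ z′) ⊕ dot Q u (y \\ᵛ b) ≟ᶠ w

  I : Vec (Fin q) (suc n) → Vec (Fin q) (suc n) → ℕ
  I p h = 𝟙 (incident? p h)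

  unique-height : ∀ z′ u y → sum (λ z → I (z′ ∷ u) (z ∷ y)) ≡ 1
  unique-height z′ u y =
    trans (sum-cong-≗ λ z → cong (λ l → 𝟙 (l ≟ᶠ w)) (assoc z z′ (dot Q u (y \\ᵛ b))))
          (∑-𝟙-⊕≟ (z′ ⊕ dot Q u (y \\ᵛ b)) w)

  degree : ∀ p → ∑ⱽ (suc n) (I p) ≡ q ^ n
  degree (z′ ∷ u) = begin
    sum (λ z → ∑ⱽ n (λ y → I (z′ ∷ u) (z ∷ y)))              ≡⟨ ∑ⱽ-comm-sum n (λ y z → I (z′ ∷ u) (z ∷ y)) ⟨
    ∑ⱽ n (λ y → sum (λ z → I (z′ ∷ u) (z ∷ y)))              ≡⟨ ∑ⱽ-cong n (unique-height z′ u) ⟩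
    ∑ⱽ {q} n (λ _ → 1)                                        ≡⟨ ∑ⱽ-const {q} n 1 ⟩
    q ^ n * 1                                                 ≡⟨ *-identityʳ (q ^ n) ⟩
    q ^ n                                                     ∎
    where open ≡-Reasoning

  common-lines : ∀ z₁ u₁ z₂ u₂ → ∑ⱽ (suc n) (λ h → I (z₁ ∷ u₁) h * I (z₂ ∷ u₂) h)
                                  ≤ ∑ⱽ n (λ y → coincide z₁ u₁ z₂ u₂ (y \\ᵛ b))
  common-lines z₁ u₁ z₂ u₂ = begin
    sum (λ z → ∑ⱽ n (λ y → I₁ z y * I₂ z y))      ≡⟨ ∑ⱽ-comm-sum n (λ y z → I₁ z y * I₂ z y) ⟨
    ∑ⱽ n (λ y → sum (λ z → I₁ z y * I₂ z y))      ≤⟨ ∑ⱽ-mono n (λ y → ∑-mono (λ z → pointwise z y)) ⟩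
    ∑ⱽ n (λ y → sum (λ z → C y * I₁ z y))          ≡⟨ ∑ⱽ-cong n (λ y → *-distribˡ-sum (C y) (λ z → I₁ z y)) ⟨
    ∑ⱽ n (λ y → C y * sum (λ z → I₁ z y))          ≡⟨ ∑ⱽ-cong n (λ y → cong (C y *_) (unique-height z₁ u₁ y)) ⟩
    ∑ⱽ n (λ y → C y * 1)                           ≡⟨ ∑ⱽ-cong n (λ y → *-identityʳ (C y)) ⟩
    ∑ⱽ n C                                         ∎
    where
    open ≤-Reasoning
    I₁ I₂ : Fin q → Vec (Fin q) n → ℕ
    I₁ z y = I (z₁ ∷ u₁) (z ∷ y)
    I₂ z y = I (z₂ ∷ u₂) (z ∷ y)
    C : Vec (Fin q) n → ℕ
    C y = coincide z₁ u₁ z₂ u₂ (y \\ᵛ b)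
    same-offset : ∀ {z y} → Incident (z₁ ∷ u₁) (z ∷ y) → Incident (z₂ ∷ u₂) (z ∷ y) →
                  z₁ ⊕ dot Q u₁ (y \\ᵛ b) ≡ z₂ ⊕ dot Q u₂ (y \\ᵛ b)
    same-offset {z} {y} on₁ on₂ = ∙-cancelˡ z _ _
      (trans (sym (assoc z z₁ _)) (trans on₁ (trans (sym on₂) (assoc z z₂ _))))
    pointwise : ∀ z y → I₁ z y * I₂ z y ≤ C y * I₁ z y
    pointwise z y = 𝟙*𝟙≤𝟙*𝟙 (incident? (z₁ ∷ u₁) (z ∷ y)) (incident? (z₂ ∷ u₂) (z ∷ y))
                             (z₁ ⊕ dot Q u₁ (y \\ᵛ b) ≟ᶠ z₂ ⊕ dot Q u₂ (y \\ᵛ b)) same-offset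

  codegree : ∀ p p′ → ∑ⱽ (suc n) (λ h → I p h * I p′ h) ≤ 𝟙 (p′ ≟ⱽ p) * q ^ n + q ^ m
  codegree (z₁ ∷ u₁) (z₂ ∷ u₂) with u₁ ≟ⱽ u₂
  ... | no u₁≢u₂ = begin
    ∑ⱽ (suc n) (λ h → I (z₁ ∷ u₁) h * I (z₂ ∷ u₂) h) ≤⟨ common-lines z₁ u₁ z₂ u₂ ⟩
    ∑ⱽ n (λ y → coincide z₁ u₁ z₂ u₂ (y \\ᵛ b))      ≤⟨ hyperplane-count b z₁ z₂ u₁≢u₂ ⟩
    q ^ m                                             ≤⟨ m≤n+m (q ^ m) _ ⟩
    𝟙 ((z₂ ∷ u₂) ≟ⱽ (z₁ ∷ u₁)) * q ^ n + q ^ m        ∎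
    where open ≤-Reasoning
  ... | yes refl with z₁ ≟ᶠ z₂
  ...   | yes refl = begin
    ∑ⱽ (suc n) (λ h → I (z₁ ∷ u₁) h * I (z₁ ∷ u₁) h) ≤⟨ common-lines z₁ u₁ z₁ u₁ ⟩
    ∑ⱽ n (λ y → coincide z₁ u₁ z₁ u₁ (y \\ᵛ b))
      ≤⟨ ∑ⱽ-mono n (λ y → 𝟙≤1 (z₁ ⊕ dot Q u₁ (y \\ᵛ b) ≟ᶠ z₁ ⊕ dot Q u₁ (y \\ᵛ b))) ⟩
    ∑ⱽ {q} n (λ _ → 1)                                ≡⟨ ∑ⱽ-const {q} n 1 ⟩
    q ^ n * 1                                         ≡⟨ *-comm (q ^ n) 1 ⟩
    1 * q ^ n                                         ≡⟨ cong (_* q ^ n) (𝟙-yes ((z₁ ∷ u₁) ≟ⱽ (z₁ ∷ u₁)) refl) ⟨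
    𝟙 ((z₁ ∷ u₁) ≟ⱽ (z₁ ∷ u₁)) * q ^ n                ≤⟨ m≤m+n _ (q ^ m) ⟩
    𝟙 ((z₁ ∷ u₁) ≟ⱽ (z₁ ∷ u₁)) * q ^ n + q ^ m        ∎
    where open ≤-Reasoning
  ...   | no z₁≢z₂ = begin
    ∑ⱽ (suc n) (λ h → I (z₁ ∷ u₁) h * I (z₂ ∷ u₁) h) ≤⟨ common-lines z₁ u₁ z₂ u₁ ⟩
    ∑ⱽ n (λ y → coincide z₁ u₁ z₂ u₁ (y \\ᵛ b))
      ≡⟨ ∑ⱽ-cong n (λ y → 𝟙-no (z₁ ⊕ dot Q u₁ (y \\ᵛ b) ≟ᶠ z₂ ⊕ dot Q u₁ (y \\ᵛ b)) (z₁≢z₂ ∘ ∙-cancelʳ _ z₁ z₂)) ⟩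
    ∑ⱽ {q} n (λ _ → 0)                                ≡⟨ ∑ⱽ-const {q} n 0 ⟩
    q ^ n * 0                                         ≡⟨ *-zeroʳ (q ^ n) ⟩
    0                                                 ≤⟨ z≤n ⟩
    𝟙 ((z₂ ∷ u₁) ≟ⱽ (z₁ ∷ u₁)) * q ^ n + q ^ m        ∎
    where open ≤-Reasoning

module BrickProduct {q : ℕ} (Q : Quasifield q) {m : ℕ} (X Y : Fin (suc m) → Subset q) (Z : Subset q)
                    (a b : Vec (Fin q) (suc m)) (w : Fin q) where

  open QuasifieldProperties Q
  open Incidence Q b w

  A B : Fin n → Subset q
  A i = X i ∩ _-set_ Q (lookup a i) (X i)
  B i = Y i ∩ _-set_ Q (lookup b i) (Y i)

  open SecondMoment I (q ^ n) (q ^ m) degree codegree (_∈ᵇ? (Z ∷ᶠ A))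

  H? : ∀ h → Dec (h ∈ᵇ (Z ∷ᶠ B))
  H? = _∈ᵇ? (Z ∷ᶠ B)

  incidences≢0 : ∣ Z ∣ * ∣ Z ∣ * prodFin n (λ i → ∣ A i ∣ * ∣ B i ∣) > 2 * q ^ (n + 2) →
                 incidences H? ≢ 0
  incidences≢0 large none = <⇒≱ large (begin
    ∣ Z ∣ * ∣ Z ∣ * prodFin n (λ i → ∣ A i ∣ * ∣ B i ∣)
      ≡⟨ cong (∣ Z ∣ * ∣ Z ∣ *_) (prodFin-* n (λ i → ∣ A i ∣) (λ i → ∣ B i ∣)) ⟩
    ∣ Z ∣ * ∣ Z ∣ * (prodFin n (λ i → ∣ A i ∣) * prodFin n (λ i → ∣ B i ∣))
      ≡⟨ rearrange ∣ Z ∣ (prodFin n (λ i → ∣ A i ∣)) (prodFin n (λ i → ∣ B i ∣)) ⟩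
    (∣ Z ∣ * prodFin n (λ i → ∣ B i ∣)) * (∣ Z ∣ * prodFin n (λ i → ∣ A i ∣))
      ≡⟨ cong₂ _*_ (∑ⱽ-𝟙-∈ᵇ (suc n) (Z ∷ᶠ B)) (∑ⱽ-𝟙-∈ᵇ (suc n) (Z ∷ᶠ A)) ⟨
    ∑ⱽ (suc n) (𝟙H H?) * ∣P∣
      ≤⟨ product-bound {q} {q ^ m} {∣P∣} {∑ⱽ (suc n) (𝟙∁H H?)}
                       q^m>0 (incidence-free H? none) (∣∁H∣+∣H∣ H?) ⟩
    q * (q * (q * q ^ m))
      ≡⟨ cong (q ^_) (+-comm n 2) ⟨
    q ^ (n + 2)
      ≤⟨ m≤m+n (q ^ (n + 2)) _ ⟩
    2 * q ^ (n + 2) ∎)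
    where
    open ≤-Reasoning
    instance
      q≢0 : NonZero q
      q≢0 = nonZeroIndex w
    q^m>0 : q ^ m > 0
    q^m>0 = m^n>0 q m
    rearrange : ∀ z α β → z * z * (α * β) ≡ (z * β) * (z * α)
    rearrange = solve-∀

  incident-pair : ∣ Z ∣ * ∣ Z ∣ * prodFin n (λ i → ∣ A i ∣ * ∣ B i ∣) > 2 * q ^ (n + 2) →
    Σ (Vec (Fin q) (suc n)) λ p → Σ (Vec (Fin q) (suc n)) λ h → p ∈ᵇ (Z ∷ᶠ A) × h ∈ᵇ (Z ∷ᶠ B) × Incident p h
  incident-pair large = on-line (incidence-witness H? (incidences≢0 large))
    where
    on-line : Σ _ (λ p → Σ _ λ h → p ∈ᵇ (Z ∷ᶠ A) × h ∈ᵇ (Z ∷ᶠ B) × I p h ≢ 0) →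
              Σ _ (λ p → Σ _ λ h → p ∈ᵇ (Z ∷ᶠ A) × h ∈ᵇ (Z ∷ᶠ B) × Incident p h)
    on-line (p , h , p∈P , h∈H , I≢0) = p , h , p∈P , h∈H , 𝟙≢0⇒ (incident? p h) I≢0

  factorisation : Σ _ (λ p → Σ _ λ h → p ∈ᵇ (Z ∷ᶠ A) × h ∈ᵇ (Z ∷ᶠ B) × Incident p h) →
    Σ (H Q n) λ g → Σ (H Q n) λ g′ → InBrick Q X Y Z g × InBrick Q X Y Z g′ × _·H_ Q g g′ ≡ (a , b , w)
  factorisation (z′ ∷ u , z ∷ y , p∈P , h∈H , on) =
    (u , y , z) , (u \\ᵛ a , y \\ᵛ b , z′) ,
    (proj₁ u-halves , proj₁ y-halves , h∈H zero) , (proj₂ u-halves , proj₂ y-halves , p∈P zero) ,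
    cong₂ _,_ (⊕-\\ᵛ u a) (cong₂ _,_ (⊕-\\ᵛ y b) on)
    where
    u-halves : u ∈ᵇ X × (u \\ᵛ a) ∈ᵇ X
    u-halves = ∈ᵇ-∩-set X a {u} (p∈P ∘ suc)
    y-halves : y ∈ᵇ Y × (y \\ᵛ b) ∈ᵇ Y
    y-halves = ∈ᵇ-∩-set Y b {y} (h∈H ∘ suc)

lemma4p1 : (q : ℕ) (Q : Quasifield q) (n : ℕ) → n > 0 →
  (X Y : Fin n → Subset q) (Z : Subset q) →
  (∀ i → Nonempty (X i)) → (∀ i → Nonempty (Y i)) → Nonempty Z →
  (a b : Vec (Fin q) n) →
  ∣ Z ∣ * ∣ Z ∣ * prodFin n (λ i → ∣ X i ∩ _-set_ Q (lookup a i) (X i) ∣ * ∣ Y i ∩ _-set_ Q (lookup b i) (Y i) ∣)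
    > 2 * q ^ (n + 2) →
  ∀ (z : Fin q) → Σ (H Q n) λ g → Σ (H Q n) λ h →
    InBrick Q X Y Z g × InBrick Q X Y Z h × _·H_ Q g h ≡ (a , b , z)
-- The nonemptiness hypotheses are implied by the size hypothesis.
lemma4p1 q Q (suc m) _ X Y Z _ _ _ a b large w = factorisation (incident-pair large)
  where open BrickProduct Q X Y Z a b w
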